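{- Let $p$ be a sufficiently large prime and let $\mathcal{H}$ be the $3$-uniform hypergraph with parts $V_1,V_2,V_3$ defined below. Then $\mathcal{H}$ contains no Berge $4$-cycle of type $(1,2,1,2)$; that is, there are no distinct vertices $v_1\in V_1$, $v_2\in V_2$, $v_3\in V_1$, $v_4\in V_2$ and distinct hyperedges $e_1,e_2,e_3,e_4$ of $\mathcal{H}$ with $\{v_1,v_2\}\subseteq e_1$, $\{v_2,v_3\}\subseteq e_2$, $\{v_3,v_4\}\subseteq e_3$ and $\{v_4,v_1\}\subseteq e_4$.
   Context: Let $p$ be a sufficiently large prime. In $\mathbb{F}_p$ define $T_1=\{2,3,\dots,\frac{p-1}{2}\}$, $T_2=\{\frac{p+3}{2},\dots,p-1\}$, $T_3=\mathbb{F}_p\setminus\{ -x^{2}:x\in\mathbb{F}_p\}$, $T_4=\{x: x^{2}-4x+1=0\}\cup\{x:3x-1=0\}\cup\{x:3x-2=0\}$, and $T_5=\{x: x^5-\frac{12757}{10872}x^4+\frac{1123}{3624}x^3+\frac{289}{1359}x^2-\frac{49}{453}x-\frac{2}{151}=0\}$. Choose $i\in\{1,2\}$ with $|T_i\cap T_3|\ge\frac{p-7}{4}$ and let $S_1=(T_i\cap T_3)\setminus(T_4\cup T_5)$, and $S_2=\mathbb{F}_p\setminus\{0,1\}$. For $1\le j\le 3$ let $V_j=S_1\times S_2\times S_2\times\{j\}$. For $x_1,x_2,x_3\in S_1$ and $a\in\mathbb{F}_p^{*}$ let $e(x_1,x_2,x_3,a)=\{(x_1,x_2x_3+a,x_2^{2}x_3+a,1),\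 (x_2,x_3x_1+a,x_3^{2}x_1+a,2),\ (x_3,x_1x_2+a,x_1^{2}x_2+a,3)\}$. The hypergraph $\mathcal{H}$ has vertex set $V_1\cup V_2\cup V_3$ and edge set $\{e(x_1,x_2,x_3,a): x_1,x_2,x_3\in S_1,\ a\in\mathbb{F}_p^{*},\ e(x_1,x_2,x_3,a)\subseteq V_1\cup V_2\cup V_3\}$. -}

module Defs where

open import Data.Nat using (ℕ; zero; suc; _+_; _*_; _∸_; _^_; _≤_; _<_; NonZero)
open import Data.Nat.DivMod using (_/_; _%_)
open import Data.Product using (Σ; ∃; _×_; _,_)
open import Data.Sum using (_⊎_)
open import Data.List using (List; length)
open import Data.List.Relation.Unary.All using (All)
open import Data.List.Relation.Unary.Unique.Propositional using (Unique)
open import Relation.Nullary using (¬_)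
open import Relation.Binary.PropositionalEquality using (_≡_; _≢_)

-- Arithmetic of 𝔽_p: elements of 𝔽_p are the naturals x with x < p.
module Fp (p : ℕ) .{{_ : NonZero p}} where

  infix 4 _≈_
  _≈_ : ℕ → ℕ → Set
  a ≈ b = a % p ≡ b % p

  -- additive inverse and multiplicative inverse (Fermat: d^(p-2)) in 𝔽_p
  neg : ℕ → ℕ
  neg a = (p ∸ (a % p)) % p

  inv : ℕ → ℕ
  inv d = (d ^ (p ∸ 2)) % p

  T₁ : ℕ → Set
  T₁ x = 2 ≤ x × x ≤ (p ∸ 1) / 2

  T₂ : ℕ → Set
  T₂ x = (p + 3) / 2 ≤ x × x ≤ p ∸ 1

  T : ℕ → ℕ → Set
  T 1 x = T₁ x
  T _ x = T₂ x

  T₃ : ℕ → Set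
  T₃ x = ¬ (Σ ℕ λ y → y < p × x ≡ neg (y * y))

  -- T₄ : x² - 4x + 1 = 0, or 3x - 1 = 0, or 3x - 2 = 0  (terms moved across)
  T₄ : ℕ → Set
  T₄ x = (x * x + 1 ≈ 4 * x) ⊎ ((3 * x ≈ 1) ⊎ (3 * x ≈ 2))

  -- T₅ : x⁵ - (12757/10872)x⁴ + (1123/3624)x³ + (289/1359)x² - (49/453)x - 2/151 = 0
  T₅ : ℕ → Set
  T₅ x = (x ^ 5 + (1123 * inv 3624) * x ^ 3 + (289 * inv 1359) * x ^ 2)
         ≈ ((12757 * inv 10872) * x ^ 4 + (49 * inv 453) * x + 2 * inv 151)

  -- the choice condition |T_i ∩ T₃| ≥ (p-7)/4 : a duplicate-free list of
  -- elements of T_i ∩ T₃ of length ℓ with 4ℓ ≥ p - 7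
  BigEnough : ℕ → Set
  BigEnough i = Σ (List ℕ) λ l →
    Unique l × All (λ x → x < p × T i x × T₃ x) l × p ≤ 4 * length l + 7

  S₁ : ℕ → ℕ → Set
  S₁ i x = x < p × T i x × T₃ x × ¬ T₄ x × ¬ T₅ x

  S₂ : ℕ → Set
  S₂ y = y < p × y ≢ 0 × y ≢ 1

  Vertex : Set
  Vertex = ℕ × ℕ × ℕ × ℕ

  InV : ℕ → ℕ → Vertex → Set
  InV i j (x , y , z , k) = S₁ i x × S₂ y × S₂ z × k ≡ j

  InVAll : ℕ → Vertex → Set
  InVAll i v = InV i 1 v ⊎ (InV i 2 v ⊎ InV i 3 v)

  -- an edge is the 3-set e(x₁,x₂,x₃,a); its three vertices carry distinct
  -- labels 1,2,3, so it is represented by the triple ordered by label.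
  Edge : Set
  Edge = Vertex × Vertex × Vertex

  e : ℕ → ℕ → ℕ → ℕ → Edge
  e x₁ x₂ x₃ a =
    ( (x₁ , (x₂ * x₃ + a) % p , (x₂ * x₂ * x₃ + a) % p , 1)
    , (x₂ , (x₃ * x₁ + a) % p , (x₃ * x₃ * x₁ + a) % p , 2)
    , (x₃ , (x₁ * x₂ + a) % p , (x₁ * x₁ * x₂ + a) % p , 3) )

  InEdgeSet : Edge → Vertex → Set
  InEdgeSet (u₁ , u₂ , u₃) v = v ≡ u₁ ⊎ (v ≡ u₂ ⊎ v ≡ u₃)

  IsEdge : ℕ → Edge → Set
  IsEdge i E = Σ ℕ λ x₁ → Σ ℕ λ x₂ → Σ ℕ λ x₃ → Σ ℕ λ a →
    S₁ i x₁ × S₁ i x₂ × S₁ i x₃ × 1 ≤ a × a < p ×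
    E ≡ e x₁ x₂ x₃ a × (∀ v → InEdgeSet E v → InVAll i v)

  _∈ₑ_ : Vertex → Edge → Set
  v ∈ₑ E = InEdgeSet E v

  BergeC4-1212 : ℕ → Set
  BergeC4-1212 i = Σ Vertex λ v₁ → Σ Vertex λ v₂ → Σ Vertex λ v₃ → Σ Vertex λ v₄ →
    Σ Edge λ e₁ → Σ Edge λ e₂ → Σ Edge λ e₃ → Σ Edge λ e₄ →
    InV i 1 v₁ × InV i 2 v₂ × InV i 1 v₃ × InV i 2 v₄ ×
    v₁ ≢ v₂ × v₁ ≢ v₃ × v₁ ≢ v₄ × v₂ ≢ v₃ × v₂ ≢ v₄ × v₃ ≢ v₄ ×
    IsEdge i e₁ × IsEdge i e₂ × IsEdge i e₃ × IsEdge i e₄ ×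
    e₁ ≢ e₂ × e₁ ≢ e₃ × e₁ ≢ e₄ × e₂ ≢ e₃ × e₂ ≢ e₄ × e₃ ≢ e₄ ×
    (v₁ ∈ₑ e₁ × v₂ ∈ₑ e₁) × (v₂ ∈ₑ e₂ × v₃ ∈ₑ e₂) ×
    (v₃ ∈ₑ e₃ × v₄ ∈ₑ e₃) × (v₄ ∈ₑ e₄ × v₁ ∈ₑ e₄)

{-# OPTIONS --safe #-}
-- Write eₖ = e uₖ wₖ tₖ aₖ and W x = x (x - 1). Two edges through a common vertex of label 1 share
-- their first parameter, and subtracting the two coordinate equations at that vertex gives
-- W(wₖ) tₖ ≡ W(wₗ) tₗ (mod p); through a common vertex of label 2 they share the second parameter
-- and W(tₖ) uₖ ≡ W(tₗ) uₗ. So around a (1,2,1,2) cycle u₁ = u₄ = u, w₁ = w₂ = w, u₂ = u₃ = u',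
-- w₃ = w₄ = w', and the four relations combine to W(w) (W(w) - W(w')) (u' t₂ - u t₁) ≡ 0.
-- Here W(w) ≢ 0 since w ∉ {0, 1}; W(w) ≡ W(w') means (w - w') (w + w' - 1) ≡ 0, which forces w = w'
-- because w + w' ≢ 1 on T₁ and on T₂, and then e₁ = e₄; and u' t₂ ≡ u t₁ forces t₁ = t₂, then e₁ = e₂.
module Submission where

open import Defs
open import Data.Nat using (ℕ; _≤_; NonZero)
open import Data.Nat.Primality using (Prime)
open import Data.Product using (Σ)
open import Data.Sum using (_⊎_)
open import Relation.Nullary using (¬_)
open import Relation.Binary.PropositionalEquality using (_≡_)

import Data.Nat as ℕ
open import Data.Nat using (zero; suc; _<_; _∸_; s≤s; z≤n)
open import Data.Nat.Properties
  using ( ≤-trans; ≤-<-trans; <-trans; <⇒≱; ≤-pred; n<1+n; m≤m+n; m∸n≤m; ⊔-pres-<m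
        ; +-comm; +-identityʳ; +-mono-≤; +-mono-<; +-monoˡ-≤; +-cancelˡ-≤
        ; *-comm; *-identityˡ; *-cancelʳ-<; module ≤-Reasoning )
open import Data.Nat.DivMod using (_/_; _%_; m≡m%n+[m/n]*n; m%n<n; m/n*n≤m; /-monoˡ-≤)
import Data.Nat.Divisibility as ℕᵈ
open import Data.Nat.Primality using (euclidsLemma)
open import Data.Integer using (ℤ; +_; 1ℤ; _+_; _-_; _*_)
import Data.Integer as ℤ
open import Data.Integer.Properties
  using (pos-+; pos-*; m-n≡m⊖n; ⊖-≥; ∣m⊝n∣≤m⊔n; ∣i∣≡0⇒i≡0; i-j≡0⇒i≡j; +-injective; abs-*)
import Data.Integer.Properties as ℤ
open import Data.Integer.Divisibility.Signed
  using (_∣_; divides; ∣ᵤ⇒∣; ∣⇒∣ᵤ; ∣m∣n⇒∣m+n; ∣m∣n⇒∣m-n; ∣n⇒∣m*n; ∣m⇒∣m*n)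
open import Data.Integer.Tactic.RingSolver using (solve-∀)
open import Data.Product using (_,_; _×_; proj₁; proj₂)
open import Data.Sum using (inj₁; inj₂; [_,_]′)
import Data.Sum as Sum
open import Data.Empty using (⊥-elim)
open import Function using (_∘_; id; _∋_)
open import Relation.Binary.PropositionalEquality using (refl; sym; trans; cong; cong₂; subst; subst₂; module ≡-Reasoning)

private
  variable
    m n p : ℕ

n*2≡n+n : ∀ n → n ℕ.* 2 ≡ n ℕ.+ n
n*2≡n+n n = trans (*-comm n 2) (cong (n ℕ.+_) (+-identityʳ n))

k*n<m<[1+k]*n⇒n∤m : ∀ k → k ℕ.* n < m → m < suc k ℕ.* n → ¬ (n ℕᵈ.∣ m)
k*n<m<[1+k]*n⇒n∤m {n} k kn<qn qn<[1+k]n (ℕᵈ.divides q refl) =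
  <⇒≱ (*-cancelʳ-< n k q kn<qn) (≤-pred (*-cancelʳ-< n q (suc k) qn<[1+k]n))

∣∧<⇒≡0 : n < p → p ℕᵈ.∣ n → n ≡ 0
∣∧<⇒≡0 {zero}      _   _   = refl
∣∧<⇒≡0 {suc n} {p} n<p p∣n =
  ⊥-elim (k*n<m<[1+k]*n⇒n∤m 0 (s≤s z≤n) (subst (suc n <_) (sym (*-identityˡ p)) n<p) p∣n)

∣[m-n]⇒≡ : m < p → n < p → + p ∣ + m - + n → m ≡ n
∣[m-n]⇒≡ {m} {p} {n} m<p n<p p∣m-n =
  +-injective (i-j≡0⇒i≡j _ _ (∣i∣≡0⇒i≡0 (∣∧<⇒≡0 ∣m-n∣<p (∣⇒∣ᵤ p∣m-n))))
  where
  ∣m-n∣<p : ℤ.∣ + m - + n ∣ < p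
  ∣m-n∣<p = subst (_< p) (cong ℤ.∣_∣ (sym (m-n≡m⊖n m n)))
              (≤-<-trans (∣m⊝n∣≤m⊔n m n) (⊔-pres-<m m<p n<p))

euclidsLemmaℤ : ∀ i j → Prime p → + p ∣ i * j → (+ p ∣ i) ⊎ (+ p ∣ j)
euclidsLemmaℤ i j p-prime p∣ij =
  Sum.map ∣ᵤ⇒∣ ∣ᵤ⇒∣ (euclidsLemma ℤ.∣ i ∣ ℤ.∣ j ∣ p-prime (subst (_ ℕᵈ.∣_) (abs-* i j) (∣⇒∣ᵤ p∣ij)))

∤∧∣*⇒∣ : ∀ i j → Prime p → ¬ (+ p ∣ i) → + p ∣ i * j → + p ∣ j
∤∧∣*⇒∣ i j p-prime p∤i p∣ij = [ ⊥-elim ∘ p∤i , id ]′ (euclidsLemmaℤ i j p-prime p∣ij)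

[m/2]+[m/2]≤m : ∀ m → m / 2 ℕ.+ m / 2 ≤ m
[m/2]+[m/2]≤m m = subst (_≤ m) (n*2≡n+n (m / 2)) (m/n*n≤m m 2)

m≤1+[m/2]+[m/2] : ∀ m → m ≤ suc (m / 2 ℕ.+ m / 2)
m≤1+[m/2]+[m/2] m = subst₂ _≤_ (sym (m≡m%n+[m/n]*n m 2)) (cong suc (n*2≡n+n (m / 2)))
  (+-monoˡ-≤ (m / 2 ℕ.* 2) (≤-pred (m%n<n m 2)))

pos-*-+ : ∀ m n o → + (m ℕ.* n ℕ.+ o) ≡ + m * + n + + o
pos-*-+ m n o = trans (pos-+ (m ℕ.* n) o) (cong (_+ + o) (pos-* m n))

%≡⇒∣[m-n] : .{{_ : NonZero p}} → m % p ≡ n % p → + p ∣ + m - + n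
%≡⇒∣[m-n] {p} {m} {n} m%p≡n%p = divides (+ (m / p) - + (n / p)) (begin
  + m - + n
    ≡⟨ cong₂ _-_ (euclidean m) (euclidean n) ⟩
  (+ (m / p) * + p + + (m % p)) - (+ (n / p) * + p + + (n % p))
    ≡⟨ cong (λ r → (+ (m / p) * + p + + r) - (+ (n / p) * + p + + (n % p))) m%p≡n%p ⟩
  (+ (m / p) * + p + + (n % p)) - (+ (n / p) * + p + + (n % p))
    ≡⟨ quotients (+ (m / p)) (+ (n / p)) (+ p) (+ (n % p)) ⟩
  (+ (m / p) - + (n / p)) * + p ∎)
  where
  open ≡-Reasoning
  euclidean : ∀ k → + k ≡ + (k / p) * + p + + (k % p)
  euclidean k = trans (cong +_ (trans (m≡m%n+[m/n]*n k p) (+-comm (k % p) _))) (pos-*-+ (k / p) p (k % p))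
  quotients : ∀ q q' d r → (q * d + r) - (q' * d + r) ≡ (q - q') * d
  quotients = solve-∀

-- Eliminating t₃ and t₄ through the first and third relations (W' t₄ ≡ W t₁, W' t₃ ≡ W t₂) in W'²
-- times the fourth one and adding W² times the second leaves W (W - W') (u' t₂ - u t₁).
cycle-identity : ∀ u u' w w' t₁ t₂ t₃ t₄ →
  let W = w * (w - 1ℤ); W' = w' * (w' - 1ℤ)
      E₁ = W * t₁ - W' * t₄
      E₂ = t₁ * (t₁ - 1ℤ) * u - t₂ * (t₂ - 1ℤ) * u'
      E₃ = W * t₂ - W' * t₃
      E₄ = t₃ * (t₃ - 1ℤ) * u' - t₄ * (t₄ - 1ℤ) * u
  in W' * W' * E₄ + W * W * E₂ + u' * E₃ * (W * t₂ + W * t₂ - W' - E₃) - u * E₁ * (W * t₁ + W * t₁ - W' - E₁)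
     ≡ W * (W - W') * (u' * t₂ - u * t₁)
cycle-identity = solve-∀

cycle-relation : ∀ {d} u u' w w' t₁ t₂ t₃ t₄ →
  d ∣ w * (w - 1ℤ) * t₁ - w' * (w' - 1ℤ) * t₄ →
  d ∣ t₁ * (t₁ - 1ℤ) * u - t₂ * (t₂ - 1ℤ) * u' →
  d ∣ w * (w - 1ℤ) * t₂ - w' * (w' - 1ℤ) * t₃ →
  d ∣ t₃ * (t₃ - 1ℤ) * u' - t₄ * (t₄ - 1ℤ) * u →
  d ∣ w * (w - 1ℤ) * (w * (w - 1ℤ) - w' * (w' - 1ℤ)) * (u' * t₂ - u * t₁)
cycle-relation {d} u u' w w' t₁ t₂ t₃ t₄ d∣E₁ d∣E₂ d∣E₃ d∣E₄ =
  subst (d ∣_) (cycle-identity u u' w w' t₁ t₂ t₃ t₄)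
    (∣m∣n⇒∣m-n (∣m∣n⇒∣m+n (∣m∣n⇒∣m+n (∣n⇒∣m*n (W' * W') d∣E₄) (∣n⇒∣m*n (W * W) d∣E₂))
                          (∣m⇒∣m*n (W * t₂ + W * t₂ - W' - E₃) (∣n⇒∣m*n u' d∣E₃)))
               (∣m⇒∣m*n (W * t₁ + W * t₁ - W' - E₁) (∣n⇒∣m*n u d∣E₁)))
  where
  W W' E₁ E₃ : ℤ
  W = w * (w - 1ℤ)
  W' = w' * (w' - 1ℤ)
  E₁ = W * t₁ - W' * t₄
  E₃ = W * t₂ - W' * t₃

*-distribˡ-difference : ∀ s t t' → s * t - s * t' ≡ s * (t - t')
*-distribˡ-difference = solve-∀

+-cancelˡ-difference : ∀ s a a' → (s + a) - (s + a') ≡ a - a'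
+-cancelˡ-difference = solve-∀

x[x-1]-difference : ∀ w w' → w * (w - 1ℤ) - w' * (w' - 1ℤ) ≡ (w - w') * (w + w' - 1ℤ)
x[x-1]-difference = solve-∀

ratio-identity : ∀ u u' t₁ t₂ →
  t₁ * (t₁ - 1ℤ) * u - t₂ * (t₂ - 1ℤ) * u' + (t₂ - 1ℤ) * (u' * t₂ - u * t₁) ≡ u * t₁ * (t₁ - t₂)
ratio-identity = solve-∀

module _ (p : ℕ) .{{_ : NonZero p}} (p-prime : Prime p) where
  open Fp p

  -- The vertices of e x₁ x₂ x₃ a carry the coordinates (x t + a, x² t + a) with (x, t) = (x₂, x₃),
  -- (x₃, x₁), (x₁, x₂); Coincide says that two such coordinate pairs agree in 𝔽_p.
  record Coincide (x t a x' t' a' : ℕ) : Set where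
    constructor _,_
    field
      linear    : x ℕ.* t ℕ.+ a ≈ x' ℕ.* t' ℕ.+ a'
      quadratic : x ℕ.* x ℕ.* t ℕ.+ a ≈ x' ℕ.* x' ℕ.* t' ℕ.+ a'

  coincide⇒∣ : ∀ {x t a x' t' a'} → Coincide x t a x' t' a' →
    + p ∣ (+ x * + t + + a) - (+ x' * + t' + + a') ×
    + p ∣ + x * (+ x - 1ℤ) * + t - + x' * (+ x' - 1ℤ) * + t'
  coincide⇒∣ {x} {t} {a} {x'} {t'} {a'} (linear , quadratic) =
    p∣linear , subst (+ p ∣_) (difference (+ x) (+ t) (+ a) (+ x') (+ t') (+ a')) (∣m∣n⇒∣m-n p∣quadratic p∣linear)
    where
    cast : ∀ {m n m' n'} → + m ≡ m' → + n ≡ n' → m % p ≡ n % p → + p ∣ m' - n'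
    cast refl refl = %≡⇒∣[m-n]
    p∣linear : + p ∣ (+ x * + t + + a) - (+ x' * + t' + + a')
    p∣linear = cast (pos-*-+ x t a) (pos-*-+ x' t' a') linear
    p∣quadratic : + p ∣ (+ x * + x * + t + + a) - (+ x' * + x' * + t' + + a')
    p∣quadratic = cast (trans (pos-*-+ (x ℕ.* x) t a) (cong (λ s → s * + t + + a) (pos-* x x)))
                       (trans (pos-*-+ (x' ℕ.* x') t' a') (cong (λ s → s * + t' + + a') (pos-* x' x')))
                       quadratic
    difference : ∀ x t a x' t' a' →
      (x * x * t + a - (x' * x' * t' + a')) - (x * t + a - (x' * t' + a')) ≡ x * (x - 1ℤ) * t - x' * (x' - 1ℤ) * t'
    difference = solve-∀

  S₂⇒1<p : ∀ {x} → S₂ x → 1 < p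
  S₂⇒1<p {zero}        (_ , x≢0 , _) = ⊥-elim (x≢0 refl)
  S₂⇒1<p {suc zero}    (_ , _ , x≢1) = ⊥-elim (x≢1 refl)
  S₂⇒1<p {suc (suc x)} (x<p , _ , _) = ≤-<-trans (s≤s z≤n) x<p

  S₂⇒∤ : ∀ {x} → S₂ x → ¬ (+ p ∣ + x)
  S₂⇒∤ {x} sx@(x<p , x≢0 , _) p∣x =
    x≢0 (∣[m-n]⇒≡ x<p (≤-<-trans z≤n x<p) (subst (+ p ∣_) (sym (ℤ.+-identityʳ (+ x))) p∣x))

  S₂⇒∤[x-1] : ∀ {x} → S₂ x → ¬ (+ p ∣ + x - 1ℤ)
  S₂⇒∤[x-1] sx@(x<p , _ , x≢1) p∣x-1 = x≢1 (∣[m-n]⇒≡ x<p (S₂⇒1<p sx) p∣x-1)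

  S₂⇒∤x[x-1] : ∀ {x} → S₂ x → ¬ (+ p ∣ + x * (+ x - 1ℤ))
  S₂⇒∤x[x-1] {x} sx p∣ = [ S₂⇒∤ sx , S₂⇒∤[x-1] sx ]′ (euclidsLemmaℤ (+ x) (+ x - 1ℤ) p-prime p∣)

  e-cong : ∀ {x₁ x₂ x₃ a y₁ y₂ y₃ b} → x₁ ≡ y₁ → x₂ ≡ y₂ → x₃ ≡ y₃ → a ≡ b → e x₁ x₂ x₃ a ≡ e y₁ y₂ y₃ b
  e-cong refl refl refl refl = refl

  coincide-cancel : ∀ {x t a t' a'} → S₂ x → t < p → t' < p → a < p → a' < p →
    Coincide x t a x t' a' → t ≡ t' × a ≡ a'
  coincide-cancel {x} {t} {a} {t'} {a'} sx t<p t'<p a<p a'<p c = t≡t' , a≡a'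
    where
    t≡t' : t ≡ t'
    t≡t' = ∣[m-n]⇒≡ t<p t'<p (∤∧∣*⇒∣ (+ x * (+ x - 1ℤ)) (+ t - + t') p-prime (S₂⇒∤x[x-1] sx)
             (subst (+ p ∣_) (*-distribˡ-difference (+ x * (+ x - 1ℤ)) (+ t) (+ t')) (proj₂ (coincide⇒∣ c))))
    a≡a' : a ≡ a'
    a≡a' = ∣[m-n]⇒≡ a<p a'<p (subst (+ p ∣_) (+-cancelˡ-difference (+ x * + t') (+ a) (+ a'))
             (subst (λ s → + p ∣ (+ x * + s + + a) - (+ x * + t' + + a')) t≡t' (proj₁ (coincide⇒∣ c))))

  x[x-1]-cancel : ∀ {w w'} → S₂ w → w' < p → ¬ (+ p ∣ + w + + w' - 1ℤ) →
    + p ∣ + w * (+ w - 1ℤ) - + w' * (+ w' - 1ℤ) → w ≡ w'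
  x[x-1]-cancel {w} {w'} sw w'<p p∤w+w'-1 p∣ =
    [ ∣[m-n]⇒≡ (proj₁ sw) w'<p , ⊥-elim ∘ p∤w+w'-1 ]′
      (euclidsLemmaℤ (+ w - + w') (+ w + + w' - 1ℤ) p-prime (subst (+ p ∣_) (x[x-1]-difference (+ w) (+ w')) p∣))

  coincide-ratio : ∀ {t₁ u a₁ t₂ u' a₂} → S₂ u → S₂ t₁ → t₂ < p → Coincide t₁ u a₁ t₂ u' a₂ →
    + p ∣ + u' * + t₂ - + u * + t₁ → t₁ ≡ t₂
  coincide-ratio {t₁} {u} {_} {t₂} {u'} su st₁ t₂<p c p∣B-A =
    ∣[m-n]⇒≡ (proj₁ st₁) t₂<p (∤∧∣*⇒∣ (+ u * + t₁) (+ t₁ - + t₂) p-prime p∤ut₁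
      (subst (+ p ∣_) (ratio-identity (+ u) (+ u') (+ t₁) (+ t₂))
        (∣m∣n⇒∣m+n (proj₂ (coincide⇒∣ c)) (∣n⇒∣m*n (+ t₂ - 1ℤ) p∣B-A))))
    where
    p∤ut₁ : ¬ (+ p ∣ + u * + t₁)
    p∤ut₁ = [ S₂⇒∤ su , S₂⇒∤ st₁ ]′ ∘ euclidsLemmaℤ (+ u) (+ t₁) p-prime

  quadrilateral-collapses : ∀ {u u' w w' t₁ t₂ t₃ t₄ a₁ a₂ a₃ a₄} →
    S₂ u → S₂ w → S₂ t₁ → u' < p → w' < p → t₂ < p → t₄ < p → a₁ < p → a₂ < p → a₄ < p →
    ¬ (+ p ∣ + w + + w' - 1ℤ) →
    Coincide w t₁ a₁ w' t₄ a₄ → Coincide t₁ u a₁ t₂ u' a₂ →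
    Coincide w t₂ a₂ w' t₃ a₃ → Coincide t₃ u' a₃ t₄ u a₄ →
    e u w t₁ a₁ ≡ e u' w t₂ a₂ ⊎ e u w t₁ a₁ ≡ e u w' t₄ a₄
  quadrilateral-collapses {u} {u'} {w} {w'} {t₁} {t₂} {t₃} {t₄} {a₁} {a₂} {a₃} {a₄}
    su sw st₁ u'<p w'<p t₂<p t₄<p a₁<p a₂<p a₄<p p∤w+w'-1 c₁ c₂ c₃ c₄ =
    [ [ ⊥-elim ∘ S₂⇒∤x[x-1] sw , same-w ]′ ∘ euclidsLemmaℤ W (W - W') p-prime , same-ratio ]′
      (euclidsLemmaℤ (W * (W - W')) (+ u' * + t₂ - + u * + t₁) p-prime
        (cycle-relation (+ u) (+ u') (+ w) (+ w') (+ t₁) (+ t₂) (+ t₃) (+ t₄)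
          (proj₂ (coincide⇒∣ c₁)) (proj₂ (coincide⇒∣ c₂)) (proj₂ (coincide⇒∣ c₃)) (proj₂ (coincide⇒∣ c₄))))
    where
    W W' : ℤ
    W = + w * (+ w - 1ℤ)
    W' = + w' * (+ w' - 1ℤ)

    same-ratio : + p ∣ + u' * + t₂ - + u * + t₁ → e u w t₁ a₁ ≡ e u' w t₂ a₂ ⊎ e u w t₁ a₁ ≡ e u w' t₄ a₄
    same-ratio p∣B-A =
      let u≡u' , a₁≡a₂ = coincide-cancel st₁ (proj₁ su) u'<p a₁<p a₂<p (subst (λ s → Coincide t₁ u a₁ s u' a₂) (sym t₁≡t₂) c₂)
      in inj₁ (e-cong u≡u' refl t₁≡t₂ a₁≡a₂)
      where
      t₁≡t₂ : t₁ ≡ t₂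
      t₁≡t₂ = coincide-ratio su st₁ t₂<p c₂ p∣B-A

    same-w : + p ∣ W - W' → e u w t₁ a₁ ≡ e u' w t₂ a₂ ⊎ e u w t₁ a₁ ≡ e u w' t₄ a₄
    same-w p∣W-W' =
      let t₁≡t₄ , a₁≡a₄ = coincide-cancel sw (proj₁ st₁) t₄<p a₁<p a₄<p (subst (λ s → Coincide w t₁ a₁ s t₄ a₄) (sym w≡w') c₁)
      in inj₂ (e-cong refl w≡w' t₁≡t₄ a₁≡a₄)
      where
      w≡w' : w ≡ w'
      w≡w' = x[x-1]-cancel sw w'<p p∤w+w'-1 p∣W-W'

  T⇒2≤ : ∀ {i x} → (i ≡ 1 ⊎ i ≡ 2) → T i x → 2 ≤ x
  T⇒2≤ (inj₁ refl) = proj₁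
  T⇒2≤ (inj₂ refl) = ≤-trans (/-monoˡ-≤ 2 (+-monoˡ-≤ 3 (ℕ.>-nonZero⁻¹ p))) ∘ proj₁

  S₁⇒S₂ : ∀ {i x} → (i ≡ 1 ⊎ i ≡ 2) → S₁ i x → S₂ x
  S₁⇒S₂ i∈12 (x<p , tx , _) with T⇒2≤ i∈12 tx
  ... | s≤s (s≤s _) = x<p , (λ ()) , (λ ())

  -- Both T₁ + T₁ and T₂ + T₂ avoid 1 modulo p: w + w' - 1 lies in (0, p) resp. (p, 2p).
  T-sum∤ : ∀ {i w w'} → (i ≡ 1 ⊎ i ≡ 2) → S₁ i w → S₁ i w' → ¬ (+ p ∣ + w + + w' - 1ℤ)
  T-sum∤ {i} {w} {w'} i∈12 (w<p , tw , _) (w'<p , tw' , _) p∣w+w'-1 =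
    between i∈12 (T⇒2≤ i∈12 tw) tw tw' (∣⇒∣ᵤ (subst (+ p ∣_) as-ℕ p∣w+w'-1))
    where
    as-ℕ : + w + + w' - 1ℤ ≡ + (w ℕ.+ w' ∸ 1)
    as-ℕ = trans (cong (_- 1ℤ) (sym (pos-+ w w')))
             (trans (m-n≡m⊖n (w ℕ.+ w') 1) (⊖-≥ (≤-trans (s≤s z≤n) (≤-trans (T⇒2≤ i∈12 tw) (m≤m+n w w')))))
    between : (i ≡ 1 ⊎ i ≡ 2) → 2 ≤ w → T i w → T i w' → ¬ (p ℕᵈ.∣ w ℕ.+ w' ∸ 1)
    between (inj₁ refl) (s≤s (s≤s _)) (_ , w≤h) (_ , w'≤h) =
      k*n<m<[1+k]*n⇒n∤m 0 (s≤s z≤n) (subst (w ℕ.+ w' ∸ 1 <_) (sym (*-identityˡ p)) (begin-strict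
        w ℕ.+ w' ∸ 1                 <⟨ n<1+n _ ⟩
        w ℕ.+ w'                     ≤⟨ +-mono-≤ w≤h w'≤h ⟩
        (p ∸ 1) / 2 ℕ.+ (p ∸ 1) / 2  ≤⟨ [m/2]+[m/2]≤m (p ∸ 1) ⟩
        p ∸ 1                        ≤⟨ m∸n≤m p 1 ⟩
        p                            ∎))
      where open ≤-Reasoning
    between (inj₂ refl) (s≤s (s≤s _)) (g≤w , _) (g≤w' , _) =
      k*n<m<[1+k]*n⇒n∤m 1 (subst (_< w ℕ.+ w' ∸ 1) (sym (*-identityˡ p)) (s≤s (+-cancelˡ-≤ 3 _ _ (begin
        3 ℕ.+ p                               ≡⟨ +-comm 3 p ⟩
        p ℕ.+ 3                               ≤⟨ m≤1+[m/2]+[m/2] (p ℕ.+ 3) ⟩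
        suc ((p ℕ.+ 3) / 2 ℕ.+ (p ℕ.+ 3) / 2) ≤⟨ s≤s (+-mono-≤ g≤w g≤w') ⟩
        suc (w ℕ.+ w')                        ∎))))
        (subst (w ℕ.+ w' ∸ 1 <_) (cong (p ℕ.+_) (sym (+-identityʳ p)))
          (<-trans (n<1+n _) (+-mono-< w<p w'<p)))
      where open ≤-Reasoning

  coordinates-≡ : ∀ {x y z k x' y' z' k'} → (Vertex ∋ (x , y , z , k)) ≡ (x' , y' , z' , k') → x ≡ x' × y ≡ y' × z ≡ z'
  coordinates-≡ refl = refl , refl , refl

  vertex₁ vertex₂ : Edge → Vertex
  vertex₁ (v , _ , _) = v
  vertex₂ (_ , v , _) = v

  ∈e⇒≡vertex₁ : ∀ {x y z x₁ x₂ x₃ a} → (x , y , z , 1) ∈ₑ e x₁ x₂ x₃ a → (x , y , z , 1) ≡ vertex₁ (e x₁ x₂ x₃ a)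
  ∈e⇒≡vertex₁ (inj₁ v≡v₁) = v≡v₁
  ∈e⇒≡vertex₁ (inj₂ (inj₁ ()))
  ∈e⇒≡vertex₁ (inj₂ (inj₂ ()))

  ∈e⇒≡vertex₂ : ∀ {x y z x₁ x₂ x₃ a} → (x , y , z , 2) ∈ₑ e x₁ x₂ x₃ a → (x , y , z , 2) ≡ vertex₂ (e x₁ x₂ x₃ a)
  ∈e⇒≡vertex₂ (inj₁ ())
  ∈e⇒≡vertex₂ (inj₂ (inj₁ v≡v₂)) = v≡v₂
  ∈e⇒≡vertex₂ (inj₂ (inj₂ ()))

  common-vertex₁ : ∀ {x y z x₁ x₂ x₃ a y₁ y₂ y₃ b} →
    (x , y , z , 1) ∈ₑ e x₁ x₂ x₃ a → (x , y , z , 1) ∈ₑ e y₁ y₂ y₃ b → x₁ ≡ y₁ × Coincide x₂ x₃ a y₂ y₃ b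
  common-vertex₁ v∈E v∈E' =
    let x₁≡y₁ , linear , quadratic = coordinates-≡ (trans (sym (∈e⇒≡vertex₁ v∈E)) (∈e⇒≡vertex₁ v∈E'))
    in x₁≡y₁ , (linear , quadratic)

  common-vertex₂ : ∀ {x y z x₁ x₂ x₃ a y₁ y₂ y₃ b} →
    (x , y , z , 2) ∈ₑ e x₁ x₂ x₃ a → (x , y , z , 2) ∈ₑ e y₁ y₂ y₃ b → x₂ ≡ y₂ × Coincide x₃ x₁ a y₃ y₁ b
  common-vertex₂ v∈E v∈E' =
    let x₂≡y₂ , linear , quadratic = coordinates-≡ (trans (sym (∈e⇒≡vertex₂ v∈E)) (∈e⇒≡vertex₂ v∈E'))
    in x₂≡y₂ , (linear , quadratic)

  cycle-collapses : ∀ {i u₁ w₁ t₁ a₁ u₂ w₂ t₂ a₂ u₃ w₃ t₃ a₃ u₄ w₄ t₄ a₄} → (i ≡ 1 ⊎ i ≡ 2) →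
    S₁ i u₁ → S₁ i w₁ → S₁ i t₁ → S₁ i u₂ → S₁ i t₂ → S₁ i w₃ → S₁ i t₄ → a₁ < p → a₂ < p → a₄ < p →
    u₁ ≡ u₄ × Coincide w₁ t₁ a₁ w₄ t₄ a₄ → w₁ ≡ w₂ × Coincide t₁ u₁ a₁ t₂ u₂ a₂ →
    u₂ ≡ u₃ × Coincide w₂ t₂ a₂ w₃ t₃ a₃ → w₃ ≡ w₄ × Coincide t₃ u₃ a₃ t₄ u₄ a₄ →
    e u₁ w₁ t₁ a₁ ≡ e u₂ w₂ t₂ a₂ ⊎ e u₁ w₁ t₁ a₁ ≡ e u₄ w₄ t₄ a₄
  cycle-collapses i∈12 su₁ sw₁ st₁ su₂ st₂ sw₃ st₄ a₁<p a₂<p a₄<p (refl , c₁) (refl , c₂) (refl , c₃) (refl , c₄) =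
    quadrilateral-collapses (S₁⇒S₂ i∈12 su₁) (S₁⇒S₂ i∈12 sw₁) (S₁⇒S₂ i∈12 st₁) (proj₁ su₂) (proj₁ sw₃)
      (proj₁ st₂) (proj₁ st₄) a₁<p a₂<p a₄<p (T-sum∤ i∈12 sw₁ sw₃) c₁ c₂ c₃ c₄

  ¬BergeC4-1212 : ∀ {i} → (i ≡ 1 ⊎ i ≡ 2) → ¬ BergeC4-1212 i
  ¬BergeC4-1212 i∈12
    ( (_ , _ , _ , _) , (_ , _ , _ , _) , (_ , _ , _ , _) , (_ , _ , _ , _) , _ , _ , _ , _
    , (_ , _ , _ , refl) , (_ , _ , _ , refl) , (_ , _ , _ , refl) , (_ , _ , _ , refl) , _ , _ , _ , _ , _ , _
    , (_ , _ , _ , _ , su₁ , sw₁ , st₁ , _ , a₁<p , refl , _)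
    , (_ , _ , _ , _ , su₂ , _ , st₂ , _ , a₂<p , refl , _)
    , (_ , _ , _ , _ , _ , sw₃ , _ , _ , _ , refl , _)
    , (_ , _ , _ , _ , _ , _ , st₄ , _ , a₄<p , refl , _)
    , e₁≢e₂ , _ , e₁≢e₄ , _ , _ , _
    , (v₁∈e₁ , v₂∈e₁) , (v₂∈e₂ , v₃∈e₂) , (v₃∈e₃ , v₄∈e₃) , (v₄∈e₄ , v₁∈e₄)) =
    [ e₁≢e₂ , e₁≢e₄ ]′
      (cycle-collapses i∈12 su₁ sw₁ st₁ su₂ st₂ sw₃ st₄ a₁<p a₂<p a₄<p
        (common-vertex₁ v₁∈e₁ v₁∈e₄) (common-vertex₂ v₂∈e₁ v₂∈e₂)
        (common-vertex₁ v₃∈e₂ v₃∈e₃) (common-vertex₂ v₄∈e₃ v₄∈e₄))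

-- Nothing in the argument needs p to be large, nor the size condition on T_i ∩ T₃.
lemma4p2 : Σ ℕ λ N → (p : ℕ) → .{{_ : NonZero p}} → Prime p → N ≤ p →
    (i : ℕ) → (i ≡ 1 ⊎ i ≡ 2) → Fp.BigEnough p i → ¬ Fp.BergeC4-1212 p i
lemma4p2 = 0 , λ p p-prime _ i i∈12 _ → ¬BergeC4-1212 p p-prime i∈12
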